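{- Let $k>2$ be an integer and let $m$ be an odd composite positive integer not divisible by $3$ with $H(m)=k$. Then $m<2\cdot 3^{k-2}+1$.
   Context: Let $\varphi$ be Euler's totient function. The height function $H$ on positive integers is defined by $H(1)=0$ and $H(n)=H(\varphi(n))+1$ for $n\ge 2$. -}

module Defs where

open import Data.Nat using (ℕ; zero; suc; _≟_)
open import Data.Nat.GCD using (gcd)
open import Data.List using (List; length; filter; upTo; map)
open import Relation.Nullary.Decidable using (⌊_⌋)

-- Euler's totient: φ n = #{ k ∈ {1,…,n} | gcd k n ≡ 1 }  (so φ 1 = 1, φ 0 = 0)
φ : ℕ → ℕ
φ n = length (filter (λ k → gcd k n ≟ 1) (map suc (upTo n)))

-- The height function H as the graph of its recursive definition:
-- H(1) = 0 and H(n) = H(φ n) + 1 for n ≥ 2.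
data Height : ℕ → ℕ → Set where
  height-one  : Height 1 0
  height-step : ∀ {n h} → Height (φ (suc (suc n))) h → Height (suc (suc n)) (suc h)

-- Let C n be the number of even terms in n, φ n, φ (φ n), … before 1 is reached. Because φ n is
-- even for n ≥ 3, only n itself can be odd, so H m = C m + 1 for odd m ≥ 3. Shapiro's key fact is
-- that C is additive, C (a b) = C a + C b; it follows from φ (p n) = p φ n for p ∣ n and
-- φ (p n) = (p − 1) φ n for p ∤ n by induction on the product. Additivity reduces bounds to primes:
-- an odd prime p = 2 r + 1 has C p = 1 + C r, whence n ≤ 3 ^ C n for all n and 3 p ≤ 2·3 ^ C p + 3.
-- If all prime factors are at least 5 these weak bounds multiply to 3 m ≤ 2·3 ^ C m for composite m,
-- which is m ≤ 2·3 ^ (k − 2).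

module Submission where

open import Defs
open import Data.Bool.Base using (Bool; true; false; _∧_; not)
open import Data.Bool.Properties using (∧-identityʳ; ∧-zeroʳ)
open import Data.List.Base using ([]; _∷_; length; filter; applyUpTo)
open import Data.List.Properties using (map-upTo)
open import Data.List.Relation.Unary.All using (All)
open import Data.Nat.Base
open import Data.Nat.Coprimality as Coprime using (Coprime; gcd≡1⇒coprime; coprime⇒gcd≡1; coprime-divisor)
open import Data.Nat.Divisibility
open import Data.Nat.GCD using (gcd; gcd-zeroˡ)
open import Data.Nat.Induction using (<-rec)
open import Data.Nat.ListAction using (product)
open import Data.Nat.Primality
  using (Prime; Composite; composite⇒nonTrivial; composite⇒¬prime; prime⇒irreducible; prime⇒nonZero
        ; prime⇒nonTrivial; euclidsLemma; prime[2])
open import Data.Nat.Primality.Factorisation using (factorise)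
open import Data.Nat.Properties
open import Algebra.Properties.CommutativeSemigroup +-commutativeSemigroup
  using () renaming (interchange to +-interchange)
open import Data.Nat.Tactic.RingSolver using (solve-∀)
open import Data.Product.Base using (_×_; _,_; map₁; ∃-syntax)
open import Data.Sum.Base using (inj₁; inj₂; [_,_]′)
open import Function.Base using (_∘_; id)
open import Function.Bundles using (_⇔_; mk⇔; module Equivalence)
open import Relation.Binary.PropositionalEquality
open import Relation.Nullary.Decidable using (Dec; yes; no; does; does-⇔; dec-true; dec-false; _×-dec_; ¬?)
open import Relation.Nullary.Negation using (¬_; contradiction)
open import Relation.Unary using (Decidable)

open Equivalence using (to; from)

private
  variable
    k m n p : ℕ

prime≢1 : Prime p → p ≢ 1
prime≢1 pp = nonTrivial⇒≢1 {{prime⇒nonTrivial pp}}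

prime>1 : Prime p → 1 < p
prime>1 {p} pp = nonTrivial⇒n>1 p {{prime⇒nonTrivial pp}}

prime>0 : Prime p → 0 < p
prime>0 pp = <-trans z<s (prime>1 pp)

prime-even : Prime p → 2 ∣ p → p ≡ 2
prime-even pp 2∣p = [ (λ ()) , sym ]′ (prime⇒irreducible pp 2∣p)

m<p*m : Prime p → 0 < m → m < p * m
m<p*m {p} {m} pp 0<m = subst (m <_) (*-comm m p) (m<m*n m p {{>-nonZero 0<m}} (prime>1 pp))

1<p*m : Prime p → 0 < m → 1 < p * m
1<p*m {p} {m} pp 0<m = <-≤-trans (prime>1 pp) (m≤m*n p m {{>-nonZero 0<m}})

m*n>0⇒n>0 : ∀ m {n} → 0 < m * n → 0 < n
m*n>0⇒n>0 m {zero}  0<m*0 = contradiction (*-zeroʳ m) (n>0⇒n≢0 0<m*0)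
m*n>0⇒n>0 m {suc n} _     = z<s

prime-factor : 1 < n → ∃[ p ] ∃[ m ] Prime p × n ≡ p * m
prime-factor {n} 1<n with factorise n {{>-nonZero (<-trans z<s 1<n)}}
... | record { factors = [] ; isFactorisation = n≡1 } = contradiction (sym n≡1) (<⇒≢ 1<n)
... | record { factors = p ∷ ps ; isFactorisation = n≡p*Πps ; factorsPrime = pp All.∷ _ } =
  p , product ps , pp , n≡p*Πps

prime-induction : (P : ℕ → Set) → P 1 →
  (∀ {p m} → Prime p → 0 < m → (∀ {k} → 0 < k → k < p * m → P k) → P (p * m)) →
  ∀ {n} → 0 < n → P n
prime-induction P P1 step {n} = <-rec (λ n → 0 < n → P n) go n
  where
  go : ∀ n → (∀ {k} → k < n → 0 < k → P k) → 0 < n → P n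
  go (suc zero)        _   _ = P1
  go n@(suc (suc _)) rec _ with prime-factor {n} (s<s z<s)
  ... | p , m , pp , n≡pm = subst P (sym n≡pm)
    (step pp (m*n>0⇒n>0 p (subst (0 <_) n≡pm z<s)) (λ {k} 0<k k<pm → rec (subst (k <_) (sym n≡pm) k<pm) 0<k))

odd⇒suc-double : ¬ 2 ∣ n → ∃[ r ] n ≡ suc (2 * r)
odd⇒suc-double {zero}          2∤0 = contradiction (2 ∣0) 2∤0
odd⇒suc-double {suc zero}      _   = 0 , refl
odd⇒suc-double {suc (suc n)} 2∤n+2 with odd⇒suc-double {n} (2∤n+2 ∘ ∣m∣n⇒∣m+n ∣-refl)
... | r , n≡1+2r = suc r , trans (cong (2 +_) n≡1+2r) (cong suc (sym (*-suc 2 r)))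

fromBool : Bool → ℕ
fromBool false = 0
fromBool true  = 1

count : (ℕ → Bool) → ℕ → ℕ
count f zero    = 0
count f (suc n) = fromBool (f 0) + count (f ∘ suc) n

length-filter-applyUpTo : ∀ {P : ℕ → Set} (P? : Decidable P) f n →
  length (filter P? (applyUpTo f n)) ≡ count (λ i → does (P? (f i))) n
length-filter-applyUpTo P? f zero = refl
length-filter-applyUpTo P? f (suc n) with does (P? (f 0))
... | true  = cong suc (length-filter-applyUpTo P? (f ∘ suc) n)
... | false = length-filter-applyUpTo P? (f ∘ suc) n

count-cong : ∀ {f g} → f ≗ g → ∀ n → count f n ≡ count g n
count-cong f≗g zero    = refl
count-cong f≗g (suc n) = cong₂ _+_ (cong fromBool (f≗g 0)) (count-cong (f≗g ∘ suc) n)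

count-≤ : ∀ f n → count f n ≤ n
count-≤ f zero = z≤n
count-≤ f (suc n) with f 0
... | true  = s≤s (count-≤ (f ∘ suc) n)
... | false = m≤n⇒m≤1+n (count-≤ (f ∘ suc) n)

count-suc : ∀ f n → count f (suc n) ≡ count f n + fromBool (f n)
count-suc f zero    = +-identityʳ (fromBool (f 0))
count-suc f (suc n) = trans (cong (fromBool (f 0) +_) (count-suc (f ∘ suc) n))
                            (sym (+-assoc (fromBool (f 0)) _ _))

count-false : ∀ f n → (∀ i → i < n → f i ≡ false) → count f n ≡ 0
count-false f zero    _     = refl
count-false f (suc n) f≡false rewrite f≡false 0 z<s =
  count-false (f ∘ suc) n (λ i i<n → f≡false (suc i) (s<s i<n))

count-+ : ∀ f m n → count f (m + n) ≡ count f m + count (λ i → f (m + i)) n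
count-+ f zero    n = refl
count-+ f (suc m) n = trans (cong (fromBool (f 0) +_) (count-+ (f ∘ suc) m n))
                            (sym (+-assoc (fromBool (f 0)) _ _))

count-periodic : ∀ f n → (∀ i → f (n + i) ≡ f i) → ∀ k → count f (k * n) ≡ k * count f n
count-periodic f n periodic zero    = refl
count-periodic f n periodic (suc k) = begin
  count f (n + k * n)                            ≡⟨ count-+ f n (k * n) ⟩
  count f n + count (λ i → f (n + i)) (k * n)    ≡⟨ cong (count f n +_) (count-cong periodic (k * n)) ⟩
  count f n + count f (k * n)                    ≡⟨ cong (count f n +_) (count-periodic f n periodic k) ⟩
  count f n + k * count f n                      ∎
  where open ≡-Reasoning

count-∧-not : ∀ f g n → count (λ i → f i ∧ g i) n + count (λ i → f i ∧ not (g i)) n ≡ count f n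
count-∧-not f g zero    = refl
count-∧-not f g (suc n) with f 0 | g 0 | count-∧-not (f ∘ suc) (g ∘ suc) n
... | true  | true  | ih = cong suc ih
... | true  | false | ih = trans (+-suc _ _) (cong suc ih)
... | false | _     | ih = ih

count-multiples : ∀ d .{{_ : NonZero d}} (f : ℕ → Bool) n →
  count (λ i → f (suc i) ∧ does (d ∣? suc i)) (n * d) ≡ count (λ j → f (d * suc j)) n
count-multiples d         f zero    = refl
count-multiples d@(suc q) f (suc n) = begin
  count h (d + n * d)                                       ≡⟨ count-+ h d (n * d) ⟩
  count h d + count (λ i → h (d + i)) (n * d)               ≡⟨ cong₂ _+_ first-block (count-cong shift (n * d)) ⟩
  fromBool (f d) + count (λ i → f (d + suc i) ∧ does (d ∣? suc i)) (n * d)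
    ≡⟨ cong (fromBool (f d) +_) (count-multiples d (λ i → f (d + i)) n) ⟩
  fromBool (f d) + count (λ j → f (d + d * suc j)) n       ≡⟨ cong₂ _+_ (cong (fromBool ∘ f) (*-identityʳ d))
                                                                        (count-cong (λ j → cong f (*-suc d (suc j))) n) ⟨
  count (λ j → f (d * suc j)) (suc n)                       ∎
  where
  open ≡-Reasoning
  h : ℕ → Bool
  h i = f (suc i) ∧ does (d ∣? suc i)

  first-block : count h d ≡ fromBool (f d)
  first-block = begin
    count h (suc q)          ≡⟨ count-suc h q ⟩
    count h q + fromBool (h q) ≡⟨ cong₂ _+_ (count-false h q below-d)
                                          (cong (fromBool ∘ (f d ∧_)) (dec-true (d ∣? d) ∣-refl)) ⟩
    fromBool (f d ∧ true)    ≡⟨ cong fromBool (∧-identityʳ (f d)) ⟩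
    fromBool (f d)           ∎
    where
    below-d : ∀ i → i < q → h i ≡ false
    below-d i i<q = trans (cong (f (suc i) ∧_) (dec-false (d ∣? suc i) (λ d∣ → <⇒≱ (s<s i<q) (∣⇒≤ d∣))))
                          (∧-zeroʳ (f (suc i)))

  shift : ∀ i → h (d + i) ≡ f (d + suc i) ∧ does (d ∣? suc i)
  shift i = cong₂ _∧_ (cong f (sym (+-suc d i))) (trans (cong (does ∘ (d ∣?_)) (sym (+-suc d i))) (d∣?-+ˡ (suc i)))
    where
    d∣?-+ˡ : ∀ x → does (d ∣? (d + x)) ≡ does (d ∣? x)
    d∣?-+ˡ x = does-⇔ (mk⇔ (λ d∣d+x → ∣m+n∣m⇒∣n d∣d+x ∣-refl) (∣m∣n⇒∣m+n ∣-refl)) (d ∣? (d + x)) (d ∣? x)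

coprime-∣ʳ : m ∣ n → Coprime k n → Coprime k m
coprime-∣ʳ m∣n k⊥n (d∣k , d∣m) = k⊥n (d∣k , ∣-trans d∣m m∣n)

coprime-*ʳ : Coprime k m → Coprime k n → Coprime k (m * n)
coprime-*ʳ k⊥m k⊥n (d∣k , d∣mn) =
  k⊥n (d∣k , coprime-divisor (λ (e∣d , e∣m) → k⊥m (∣-trans e∣d d∣k , e∣m)) d∣mn)

∤⇒coprime-prime : Prime p → ¬ p ∣ k → Coprime k p
∤⇒coprime-prime {k = k} pp p∤k (d∣k , d∣p) =
  [ id , (λ d≡p → contradiction (subst (_∣ k) d≡p d∣k) p∤k) ]′ (prime⇒irreducible pp d∣p)

coprime-prime⇒∤ : Prime p → Coprime k p → ¬ p ∣ k
coprime-prime⇒∤ pp k⊥p p∣k = prime≢1 pp (k⊥p (p∣k , ∣-refl))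

coprime-*ʳ-∣⇔ : Prime p → p ∣ n → Coprime k (p * n) ⇔ Coprime k n
coprime-*ʳ-∣⇔ {p} {n} {k} pp p∣n = mk⇔ (coprime-∣ʳ (n∣m*n p)) join
  where
  join : Coprime k n → Coprime k (p * n)
  join k⊥n = coprime-*ʳ (∤⇒coprime-prime pp (λ p∣k → prime≢1 pp (k⊥n (p∣k , p∣n)))) k⊥n

coprime-*ʳ-prime⇔ : Prime p → Coprime k (p * n) ⇔ (Coprime k n × ¬ p ∣ k)
coprime-*ʳ-prime⇔ {p} {k} {n} pp = mk⇔ split join
  where
  split : Coprime k (p * n) → Coprime k n × ¬ p ∣ k
  split k⊥pn = coprime-∣ʳ (n∣m*n p) k⊥pn , coprime-prime⇒∤ pp (coprime-∣ʳ (m∣m*n n) k⊥pn)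
  join : Coprime k n × ¬ p ∣ k → Coprime k (p * n)
  join (k⊥n , p∤k) = coprime-*ʳ (∤⇒coprime-prime pp p∤k) k⊥n

coprime-*ˡ-∤⇔ : Prime p → ¬ p ∣ n → Coprime (p * k) n ⇔ Coprime k n
coprime-*ˡ-∤⇔ {p} {n} {k} pp p∤n = mk⇔ split join
  where
  split : Coprime (p * k) n → Coprime k n
  split pk⊥n = Coprime.sym (coprime-∣ʳ (n∣m*n p) (Coprime.sym pk⊥n))
  join : Coprime k n → Coprime (p * k) n
  join k⊥n = Coprime.sym (coprime-*ʳ (∤⇒coprime-prime pp p∤n) (Coprime.sym k⊥n))

coprime-+ˡ⇔ : Coprime (n + k) n ⇔ Coprime k n
coprime-+ˡ⇔ {n} {k} = mk⇔ split Coprime.coprime-+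
  where
  split : Coprime (n + k) n → Coprime k n
  split n+k⊥n (d∣k , d∣n) = n+k⊥n (∣m∣n⇒∣m+n d∣n d∣k , d∣n)

coprimeTo : ℕ → ℕ → Bool
coprimeTo n k = does (gcd k n ≟ 1)

coprimeTo-⇔ : ∀ {k n k′ n′} → Coprime k n ⇔ Coprime k′ n′ → coprimeTo n k ≡ coprimeTo n′ k′
coprimeTo-⇔ {k} {n} {k′} {n′} k⊥n⇔ = does-⇔
  (mk⇔ (coprime⇒gcd≡1 ∘ to k⊥n⇔ ∘ gcd≡1⇒coprime) (coprime⇒gcd≡1 ∘ from k⊥n⇔ ∘ gcd≡1⇒coprime))
  (gcd k n ≟ 1) (gcd k′ n′ ≟ 1)

coprimeTo-periodic : ∀ n i → coprimeTo n (suc (n + i)) ≡ coprimeTo n (suc i)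
coprimeTo-periodic n i = trans (cong (coprimeTo n) (sym (+-suc n i))) (coprimeTo-⇔ (coprime-+ˡ⇔ {n = n} {k = suc i}))

coprimeTo-*-prime : Prime p → ∀ k → coprimeTo (p * n) k ≡ coprimeTo n k ∧ not (does (p ∣? k))
coprimeTo-*-prime {p} {n} pp k =
  does-⇔ (mk⇔ split join) (gcd k (p * n) ≟ 1) ((gcd k n ≟ 1) ×-dec ¬? (p ∣? k))
  where
  split : gcd k (p * n) ≡ 1 → gcd k n ≡ 1 × ¬ p ∣ k
  split = map₁ coprime⇒gcd≡1 ∘ to (coprime-*ʳ-prime⇔ pp) ∘ gcd≡1⇒coprime
  join : gcd k n ≡ 1 × ¬ p ∣ k → gcd k (p * n) ≡ 1
  join = coprime⇒gcd≡1 ∘ from (coprime-*ʳ-prime⇔ pp) ∘ map₁ gcd≡1⇒coprime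

φ≡count : ∀ n → φ n ≡ count (coprimeTo n ∘ suc) n
φ≡count n = trans (cong (length ∘ filter (λ k → gcd k n ≟ 1)) (map-upTo suc n))
                  (length-filter-applyUpTo (λ k → gcd k n ≟ 1) suc n)

φ-*-∣ : Prime p → p ∣ n → φ (p * n) ≡ p * φ n
φ-*-∣ {p} {n} pp p∣n = begin
  φ (p * n)                                 ≡⟨ φ≡count (p * n) ⟩
  count (coprimeTo (p * n) ∘ suc) (p * n)   ≡⟨ count-cong (λ i → coprimeTo-⇔ (coprime-*ʳ-∣⇔ {k = suc i} pp p∣n)) (p * n) ⟩
  count (coprimeTo n ∘ suc) (p * n)         ≡⟨ count-periodic (coprimeTo n ∘ suc) n (coprimeTo-periodic n) p ⟩
  p * count (coprimeTo n ∘ suc) n           ≡⟨ cong (p *_) (φ≡count n) ⟨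
  p * φ n                                   ∎
  where open ≡-Reasoning

φ-*-∤ : Prime p → ¬ p ∣ n → φ (p * n) ≡ pred p * φ n
φ-*-∤ {p} {n} pp p∤n = +-cancelʳ-≡ (φ n) (φ (p * n)) (pred p * φ n) (begin
  φ (p * n) + φ n                            ≡⟨ cong₂ _+_ coprime-non-multiples coprime-multiples ⟨
  count (λ i → g i ∧ not (D i)) (p * n) + count (λ i → g i ∧ D i) (p * n)
                                             ≡⟨ +-comm _ (count (λ i → g i ∧ D i) (p * n)) ⟩
  count (λ i → g i ∧ D i) (p * n) + count (λ i → g i ∧ not (D i)) (p * n)
                                             ≡⟨ count-∧-not g D (p * n) ⟩
  count g (p * n)                            ≡⟨ count-periodic g n (coprimeTo-periodic n) p ⟩
  p * count g n                              ≡⟨ cong (p *_) (φ≡count n) ⟨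
  p * φ n                                    ≡⟨ cong (_* φ n) (suc-pred p) ⟨
  φ n + pred p * φ n                         ≡⟨ +-comm (φ n) _ ⟩
  pred p * φ n + φ n                         ∎)
  where
  open ≡-Reasoning
  instance _ = prime⇒nonZero pp
  g D : ℕ → Bool
  g i = coprimeTo n (suc i)
  D i = does (p ∣? suc i)

  coprime-non-multiples : count (λ i → g i ∧ not (D i)) (p * n) ≡ φ (p * n)
  coprime-non-multiples = begin
    count (λ i → g i ∧ not (D i)) (p * n)    ≡⟨ count-cong (coprimeTo-*-prime pp ∘ suc) (p * n) ⟨
    count (coprimeTo (p * n) ∘ suc) (p * n)  ≡⟨ φ≡count (p * n) ⟨
    φ (p * n)                                ∎

  coprime-multiples : count (λ i → g i ∧ D i) (p * n) ≡ φ n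
  coprime-multiples = begin
    count (λ i → g i ∧ D i) (p * n)          ≡⟨ cong (count (λ i → g i ∧ D i)) (*-comm p n) ⟩
    count (λ i → g i ∧ D i) (n * p)          ≡⟨ count-multiples p (coprimeTo n) n ⟩
    count (λ j → coprimeTo n (p * suc j)) n  ≡⟨ count-cong (λ j → coprimeTo-⇔ (coprime-*ˡ-∤⇔ {k = suc j} pp p∤n)) n ⟩
    count g n                                ≡⟨ φ≡count n ⟨
    φ n                                      ∎

φ-prime : Prime p → φ p ≡ pred p
φ-prime {p} pp = begin
  φ p        ≡⟨ cong φ (*-identityʳ p) ⟨
  φ (p * 1)  ≡⟨ φ-*-∤ pp (prime≢1 pp ∘ ∣1⇒≡1) ⟩
  pred p * 1 ≡⟨ *-identityʳ (pred p) ⟩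
  pred p     ∎
  where open ≡-Reasoning

φ<n : 1 < n → φ n < n
φ<n {suc m} 1<n = begin-strict
  φ (suc m)                ≡⟨ φ≡count (suc m) ⟩
  count g (suc m)          ≡⟨ count-suc g m ⟩
  count g m + fromBool (g m)
    ≡⟨ cong (λ b → count g m + fromBool b) (dec-false (gcd (suc m) (suc m) ≟ 1) ¬self-coprime) ⟩
  count g m + 0            ≡⟨ +-identityʳ _ ⟩
  count g m                ≤⟨ count-≤ g m ⟩
  m                        <⟨ n<1+n m ⟩
  suc m                    ∎
  where
  open ≤-Reasoning
  g = coprimeTo (suc m) ∘ suc
  ¬self-coprime : gcd (suc m) (suc m) ≢ 1
  ¬self-coprime gcd≡1 = <⇒≢ 1<n (sym (gcd≡1⇒coprime gcd≡1 (∣-refl , ∣-refl)))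

φ>0 : 0 < n → 0 < φ n
φ>0 {suc m} _ = begin
  1                                   ≡⟨ cong fromBool (dec-true (gcd 1 (suc m) ≟ 1) (gcd-zeroˡ (suc m))) ⟨
  fromBool (coprimeTo (suc m) 1)      ≤⟨ m≤m+n _ _ ⟩
  count (coprimeTo (suc m) ∘ suc) (suc m) ≡⟨ φ≡count (suc m) ⟨
  φ (suc m)                           ∎
  where open ≤-Reasoning

φ-even : 2 < n → 2 ∣ φ n
φ-even 2<n = prime-induction P (λ { (s<s ()) }) step (<-trans z<s (<-trans (s<s z<s) 2<n)) 2<n
  where
  P : ℕ → Set
  P n = 2 < n → 2 ∣ φ n

  odd-2*>2 : 2 < 2 * m → ¬ 2 ∣ m → 2 < m
  odd-2*>2 {suc zero}          (s<s (s<s ()))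
  odd-2*>2 {suc (suc zero)}    _ 2∤2 = contradiction ∣-refl 2∤2
  odd-2*>2 {suc (suc (suc _))} _ _   = s<s (s<s z<s)

  step : ∀ {p m} → Prime p → 0 < m → (∀ {k} → 0 < k → k < p * m → P k) → P (p * m)
  step {p} {m} pp 0<m rec 2<pm with p ∣? m
  ... | yes p∣m = subst (2 ∣_) (sym (φ-*-∣ pp p∣m)) p*φm-even
    where
    p*φm-even : 2 ∣ p * φ m
    p*φm-even with 2 <? m
    ... | yes 2<m = ∣n⇒∣m*n p (rec 0<m (m<p*m pp 0<m) 2<m)
    ... | no 2≮m  = ∣m⇒∣m*n (φ m) (∣-reflexive (sym p≡2))
      where p≡2 = ≤-antisym (≤-trans (∣⇒≤ {{>-nonZero 0<m}} p∣m) (≮⇒≥ 2≮m)) (prime>1 pp)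
  ... | no p∤m = subst (2 ∣_) (sym (φ-*-∤ pp p∤m)) [p-1]*φm-even
    where
    [p-1]*φm-even : 2 ∣ pred p * φ m
    [p-1]*φm-even with 2 ∣? p
    ... | yes 2∣p = subst (λ q → 2 ∣ pred q * φ m) (sym p≡2)
                      (∣n⇒∣m*n 1 (rec 0<m (m<p*m pp 0<m) (odd-2*>2 (subst (λ q → 2 < q * m) p≡2 2<pm) 2∤m)))
      where
      p≡2 = prime-even pp 2∣p
      2∤m = p∤m ∘ subst (_∣ m) (sym p≡2)
    ... | no 2∤p with odd⇒suc-double 2∤p
    ...   | r , p≡1+2r = ∣m⇒∣m*n (φ m) (subst (2 ∣_) (sym (cong pred p≡1+2r)) (m∣m*n r))

evenBit : ℕ → ℕ
evenBit n = fromBool (does (2 ∣? n))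

evenBit-even : 2 ∣ n → evenBit n ≡ 1
evenBit-even {n} 2∣n = cong fromBool (dec-true (2 ∣? n) 2∣n)

evenBit-odd : ¬ 2 ∣ n → evenBit n ≡ 0
evenBit-odd {n} 2∤n = cong fromBool (dec-false (2 ∣? n) 2∤n)

evenBit-*ˡ : (2 ∣ m → 2 ∣ n) → evenBit (m * n) ≡ evenBit n
evenBit-*ˡ {m} {n} m-even⇒n-even = cong fromBool
  (does-⇔ (mk⇔ ([ m-even⇒n-even , id ]′ ∘ euclidsLemma m n prime[2]) (∣n⇒∣m*n m)) (2 ∣? m * n) (2 ∣? n))

evenBit-* : (2 ∣ m → ¬ 2 ∣ n) → evenBit (m * n) ≡ evenBit m + evenBit n
evenBit-* {m} {n} not-both with 2 ∣? m | 2 ∣? n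
... | yes 2∣m | yes 2∣n = contradiction 2∣n (not-both 2∣m)
... | yes 2∣m | no 2∤n  rewrite evenBit-even 2∣m | evenBit-odd 2∤n = evenBit-even (∣m⇒∣m*n n 2∣m)
... | no 2∤m  | yes 2∣n rewrite evenBit-odd 2∤m | evenBit-even 2∣n = evenBit-even (∣n⇒∣m*n m 2∣n)
... | no 2∤m  | no 2∤n  rewrite evenBit-odd 2∤m | evenBit-odd 2∤n =
  evenBit-odd ([ 2∤m , 2∤n ]′ ∘ euclidsLemma m n prime[2])

-- Shapiro's class function C. The fuel n suffices since φ n < n (C-fuel-cong).
C-fuel : ℕ → ℕ → ℕ
C-fuel _       zero              = 0
C-fuel _       (suc zero)        = 0
C-fuel zero    (suc (suc _))     = 0
C-fuel (suc f) n@(suc (suc _))   = C-fuel f (φ n) + evenBit n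

C : ℕ → ℕ
C n = C-fuel n n

C-fuel-cong : ∀ {f g} n → n ≤ f → n ≤ g → C-fuel f n ≡ C-fuel g n
C-fuel-cong zero              _          _          = refl
C-fuel-cong (suc zero)        _          _          = refl
C-fuel-cong n@(suc (suc _)) (s≤s n≤1+f) (s≤s n≤1+g) =
  cong (_+ evenBit n) (C-fuel-cong (φ n) (≤-trans φn<n n≤1+f) (≤-trans φn<n n≤1+g))
  where φn<n = ≤-pred (φ<n {n} (s<s z<s))

C-φ : ∀ n → 0 < n → C n ≡ C (φ n) + evenBit n
C-φ (suc zero)        _ = refl
C-φ n@(suc (suc _)) _ = cong (_+ evenBit n) (C-fuel-cong (φ n) (≤-pred (φ<n {n} (s<s z<s))) ≤-refl)

height-even : ∀ {n h} → Height n h → 2 ∣ n → h ≡ C n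
height-even height-one                       2∣1 = contradiction (∣1⇒≡1 2∣1) (λ ())
height-even (height-step {zero} height-one) _   = refl
height-even (height-step {suc k} {h} H)     2∣N = begin
  suc h               ≡⟨ cong suc (height-even H (φ-even {N} (s<s (s<s z<s)))) ⟩
  suc (C (φ N))       ≡⟨ +-comm 1 (C (φ N)) ⟩
  C (φ N) + 1         ≡⟨ cong (C (φ N) +_) (evenBit-even 2∣N) ⟨
  C (φ N) + evenBit N ≡⟨ C-φ N z<s ⟨
  C N                 ∎
  where
  open ≡-Reasoning
  N = suc (suc (suc k))

height-odd : ∀ {n h} → Height n h → 1 < n → ¬ 2 ∣ n → h ≡ suc (C n)
height-odd height-one                       (s<s ())
height-odd (height-step {zero} _)          _ 2∤2 = contradiction ∣-refl 2∤2
height-odd (height-step {suc k} {h} H)     _ 2∤N = cong suc (begin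
  h                   ≡⟨ height-even H (φ-even {N} (s<s (s<s z<s))) ⟩
  C (φ N)             ≡⟨ +-identityʳ (C (φ N)) ⟨
  C (φ N) + 0         ≡⟨ cong (C (φ N) +_) (evenBit-odd 2∤N) ⟨
  C (φ N) + evenBit N ≡⟨ C-φ N z<s ⟨
  C N                 ∎)
  where
  open ≡-Reasoning
  N = suc (suc (suc k))

AdditiveBelow : ℕ → Set
AdditiveBelow N = ∀ {a b} → 0 < a → 0 < b → a * b < N → C (a * b) ≡ C a + C b

C-*-prime : Prime p → 0 < m → AdditiveBelow (p * m) → C (p * m) ≡ C p + C m
C-*-prime {p} {m} pp 0<m additive = begin
  C (p * m)                        ≡⟨ C-φ (p * m) (<-trans z<s (1<p*m pp 0<m)) ⟩
  C (φ (p * m)) + evenBit (p * m)  ≡⟨ by-divisibility (p ∣? m) ⟩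
  C p + C m                        ∎
  where
  open ≡-Reasoning
  by-divisibility : Dec (p ∣ m) → C (φ (p * m)) + evenBit (p * m) ≡ C p + C m
  by-divisibility (yes p∣m) = begin
    C (φ (p * m)) + evenBit (p * m)  ≡⟨ cong₂ (λ x y → C x + y) (φ-*-∣ pp p∣m) (evenBit-*ˡ (λ 2∣p → ∣-trans 2∣p p∣m)) ⟩
    C (p * φ m) + evenBit m          ≡⟨ cong (_+ evenBit m) (additive (prime>0 pp) (φ>0 0<m) p*φm<p*m) ⟩
    C p + C (φ m) + evenBit m        ≡⟨ +-assoc (C p) (C (φ m)) (evenBit m) ⟩
    C p + (C (φ m) + evenBit m)      ≡⟨ cong (C p +_) (C-φ m 0<m) ⟨
    C p + C m                        ∎
    where p*φm<p*m = subst (_< p * m) (φ-*-∣ pp p∣m) (φ<n (1<p*m pp 0<m))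
  by-divisibility (no p∤m) = begin
    C (φ (p * m)) + evenBit (p * m)             ≡⟨ cong₂ (λ x y → C x + y) (φ-*-∤ pp p∤m) (evenBit-* p-even⇒m-odd) ⟩
    C (pred p * φ m) + (evenBit p + evenBit m)  ≡⟨ cong (_+ (evenBit p + evenBit m))
                                                        (additive (<⇒≤pred (prime>1 pp)) (φ>0 0<m) [p-1]*φm<p*m) ⟩
    C (pred p) + C (φ m) + (evenBit p + evenBit m)
                                                ≡⟨ +-interchange (C (pred p)) (C (φ m)) (evenBit p) (evenBit m) ⟩
    (C (pred p) + evenBit p) + (C (φ m) + evenBit m)
                                                ≡⟨ cong₂ _+_ (trans (C-φ p (prime>0 pp)) (cong (λ x → C x + evenBit p) (φ-prime pp)))
                                                            (C-φ m 0<m) ⟨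
    C p + C m                                   ∎
    where
    p-even⇒m-odd : 2 ∣ p → ¬ 2 ∣ m
    p-even⇒m-odd 2∣p 2∣m = p∤m (subst (_∣ m) (sym (prime-even pp 2∣p)) 2∣m)
    [p-1]*φm<p*m = subst (_< p * m) (φ-*-∤ pp p∤m) (φ<n (1<p*m pp 0<m))

C-*-step : ∀ {a b} → AdditiveBelow (a * b) → 0 < a → 0 < b → C (a * b) ≡ C a + C b
C-*-step {suc zero}        {b} _        _ _   = cong C (+-identityʳ b)
C-*-step {a@(suc (suc _))} {b} additive _ 0<b with prime-factor {a} (s<s z<s)
... | p , a′ , pp , a≡pa′ = begin
  C (a * b)           ≡⟨ cong C ab≡p[a′b] ⟩
  C (p * (a′ * b))    ≡⟨ C-*-prime pp 0<a′b (subst AdditiveBelow ab≡p[a′b] additive) ⟩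
  C p + C (a′ * b)    ≡⟨ cong (C p +_) (additive 0<a′ 0<b a′b<ab) ⟩
  C p + (C a′ + C b)  ≡⟨ +-assoc (C p) (C a′) (C b) ⟨
  C p + C a′ + C b    ≡⟨ cong (_+ C b) (C-*-prime pp 0<a′ additive-below-a) ⟨
  C (p * a′) + C b    ≡⟨ cong (λ x → C x + C b) a≡pa′ ⟨
  C a + C b           ∎
  where
  open ≡-Reasoning
  ab≡p[a′b] = trans (cong (_* b) a≡pa′) (*-assoc p a′ b)
  0<a′ = m*n>0⇒n>0 p (subst (0 <_) a≡pa′ z<s)
  0<a′b = m*n>0⇒n>0 p (subst (0 <_) ab≡p[a′b] (<-≤-trans 0<b (m≤n*m b a)))
  a′b<ab = subst (a′ * b <_) (sym ab≡p[a′b]) (m<p*m pp 0<a′b)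
  additive-below-a : AdditiveBelow (p * a′)
  additive-below-a 0<x 0<y xy<pa′ =
    additive 0<x 0<y (<-≤-trans xy<pa′ (subst (_≤ a * b) a≡pa′ (m≤m*n a b {{>-nonZero 0<b}})))

C-*-below : ∀ N → AdditiveBelow N
C-*-below (suc N) 0<a 0<b ab<1+N with m<1+n⇒m<n∨m≡n ab<1+N
... | inj₁ ab<N = C-*-below N 0<a 0<b ab<N
... | inj₂ refl = C-*-step (C-*-below _) 0<a 0<b

C-* : 0 < m → 0 < n → C (m * n) ≡ C m + C n
C-* 0<m 0<n = C-*-below _ 0<m 0<n (n<1+n _)

odd-prime-half>0 : ∀ {r} → Prime p → p ≡ suc (2 * r) → 0 < r
odd-prime-half>0 {r = zero}  pp refl = contradiction (prime>1 pp) (λ { (s≤s ()) })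
odd-prime-half>0 {r = suc _} _  _    = z<s

C-odd-prime : ∀ {r} → Prime p → ¬ 2 ∣ p → p ≡ suc (2 * r) → C p ≡ suc (C r)
C-odd-prime {p} {r} pp 2∤p p≡1+2r = begin
  C p                  ≡⟨ C-φ p (prime>0 pp) ⟩
  C (φ p) + evenBit p  ≡⟨ cong₂ (λ x y → C x + y) (trans (φ-prime pp) (cong pred p≡1+2r)) (evenBit-odd 2∤p) ⟩
  C (2 * r) + 0        ≡⟨ +-identityʳ (C (2 * r)) ⟩
  C (2 * r)            ≡⟨ C-* {m = 2} {n = r} z<s (odd-prime-half>0 pp p≡1+2r) ⟩
  suc (C r)            ∎
  where open ≡-Reasoning

n≤3^C : 0 < n → n ≤ 3 ^ C n
n≤3^C = prime-induction (λ n → n ≤ 3 ^ C n) (s≤s z≤n) step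
  where
  prime≤3^C : Prime p → (∀ {k} → 0 < k → k < p → k ≤ 3 ^ C k) → p ≤ 3 ^ C p
  prime≤3^C {p} pp rec with 2 ∣? p
  ... | yes 2∣p rewrite prime-even pp 2∣p = s≤s (s≤s z≤n)
  ... | no 2∤p with odd⇒suc-double 2∤p
  ...   | r , p≡1+2r = begin
    p            ≡⟨ p≡1+2r ⟩
    suc (2 * r)  ≤⟨ +-monoˡ-≤ (2 * r) 0<r ⟩
    3 * r        ≤⟨ *-monoʳ-≤ 3 (rec 0<r (subst (r <_) (sym p≡1+2r) (s≤s (m≤m+n r (r + 0))))) ⟩
    3 * 3 ^ C r  ≡⟨ cong (3 ^_) (C-odd-prime {r = r} pp 2∤p p≡1+2r) ⟨
    3 ^ C p      ∎
    where
    open ≤-Reasoning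
    0<r = odd-prime-half>0 pp p≡1+2r

  step : ∀ {p m} → Prime p → 0 < m → (∀ {k} → 0 < k → k < p * m → k ≤ 3 ^ C k) → p * m ≤ 3 ^ C (p * m)
  step {p} {m} pp 0<m rec = begin
    p * m              ≤⟨ *-mono-≤ (prime≤3^C pp (λ 0<k k<p → rec 0<k (<-≤-trans k<p (m≤m*n p m {{>-nonZero 0<m}}))))
                                   (rec 0<m (m<p*m pp 0<m)) ⟩
    3 ^ C p * 3 ^ C m  ≡⟨ ^-distribˡ-+-* 3 (C p) (C m) ⟨
    3 ^ (C p + C m)    ≡⟨ cong (3 ^_) (C-* (prime>0 pp) 0<m) ⟨
    3 ^ C (p * m)      ∎
    where open ≤-Reasoning

odd-prime-bound : Prime p → ¬ 2 ∣ p → 3 * p ≤ 2 * 3 ^ C p + 3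
odd-prime-bound {p} pp 2∤p with odd⇒suc-double 2∤p
... | r , p≡1+2r = begin
  3 * p                  ≡⟨ cong (3 *_) p≡1+2r ⟩
  3 * suc (2 * r)        ≡⟨ expand r ⟩
  2 * (3 * r) + 3        ≤⟨ +-monoˡ-≤ 3 (*-monoʳ-≤ 2 (*-monoʳ-≤ 3 (n≤3^C {n = r} (odd-prime-half>0 pp p≡1+2r)))) ⟩
  2 * (3 * 3 ^ C r) + 3  ≡⟨ cong (λ c → 2 * 3 ^ c + 3) (C-odd-prime {r = r} pp 2∤p p≡1+2r) ⟨
  2 * 3 ^ C p + 3        ∎
  where
  open ≤-Reasoning
  expand : ∀ r → 3 * suc (2 * r) ≡ 2 * (3 * r) + 3
  expand = solve-∀

-- (2 x + 3) (2 y + 3) ≤ 6 x y as soon as x, y ≥ 9.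
*-bound : ∀ {a b x y} → 3 * a ≤ 2 * x + 3 → 3 * b ≤ 2 * y + 3 → 9 ≤ x → 9 ≤ y → 3 * (a * b) ≤ 2 * (x * y)
*-bound {a} {b} 3a≤ 3b≤ 9≤x 9≤y with m≤n⇒∃[o]m+o≡n 9≤x | m≤n⇒∃[o]m+o≡n 9≤y
... | x , refl | y , refl = *-cancelˡ-≤ 3 (begin
  3 * (3 * (a * b))                                           ≡⟨ regroup a b ⟩
  (3 * a) * (3 * b)                                           ≤⟨ *-mono-≤ 3a≤ 3b≤ ⟩
  (2 * (9 + x) + 3) * (2 * (9 + y) + 3)                       ≤⟨ m≤m+n _ (45 + 12 * x + 12 * y + 2 * (x * y)) ⟩
  (2 * (9 + x) + 3) * (2 * (9 + y) + 3) + (45 + 12 * x + 12 * y + 2 * (x * y)) ≡⟨ slack x y ⟩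
  3 * (2 * ((9 + x) * (9 + y)))                               ∎)
  where
  open ≤-Reasoning
  regroup : ∀ a b → 3 * (3 * (a * b)) ≡ (3 * a) * (3 * b)
  regroup = solve-∀
  slack : ∀ x y → (2 * (9 + x) + 3) * (2 * (9 + y) + 3) + (45 + 12 * x + 12 * y + 2 * (x * y)) ≡
                  3 * (2 * ((9 + x) * (9 + y)))
  slack = solve-∀

coprime6⇒≥5 : 1 < n → ¬ 2 ∣ n → ¬ 3 ∣ n → 5 ≤ n
coprime6⇒≥5 {1}                 (s<s ())
coprime6⇒≥5 {2}                 _ 2∤2 _   = contradiction ∣-refl 2∤2
coprime6⇒≥5 {3}                 _ _   3∤3 = contradiction ∣-refl 3∤3
coprime6⇒≥5 {4}                 _ 2∤4 _   = contradiction (divides 2 refl) 2∤4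
coprime6⇒≥5 {suc (suc (suc (suc (suc _))))} _ _ _ = s≤s (s≤s (s≤s (s≤s (s≤s z≤n))))

9≤3^C : 5 ≤ n → 9 ≤ 3 ^ C n
9≤3^C {n} 5≤n = 5≤3^c⇒9≤3^c (C n) (≤-trans 5≤n (n≤3^C (≤-trans (s≤s z≤n) 5≤n)))
  where
  5≤3^c⇒9≤3^c : ∀ c → 5 ≤ 3 ^ c → 9 ≤ 3 ^ c
  5≤3^c⇒9≤3^c zero          (s≤s ())
  5≤3^c⇒9≤3^c (suc zero)    (s≤s (s≤s (s≤s ())))
  5≤3^c⇒9≤3^c (suc (suc c)) _ = *-monoʳ-≤ 3 (*-monoʳ-≤ 3 (m^n>0 3 c))

prime*-bound : Prime p → 1 < m → ¬ 2 ∣ p * m → ¬ 3 ∣ p * m →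
               3 * m ≤ 2 * 3 ^ C m + 3 → 3 * (p * m) ≤ 2 * 3 ^ C (p * m)
prime*-bound {p} {m} pp 1<m 2∤pm 3∤pm 3m≤ = begin
  3 * (p * m)              ≤⟨ *-bound {p} {m} (odd-prime-bound pp 2∤p) 3m≤ (9≤3^C 5≤p) (9≤3^C 5≤m) ⟩
  2 * (3 ^ C p * 3 ^ C m)  ≡⟨ cong (2 *_) (^-distribˡ-+-* 3 (C p) (C m)) ⟨
  2 * 3 ^ (C p + C m)      ≡⟨ cong (λ c → 2 * 3 ^ c) (C-* (prime>0 pp) (<-trans z<s 1<m)) ⟨
  2 * 3 ^ C (p * m)        ∎
  where
  open ≤-Reasoning
  2∤p = 2∤pm ∘ ∣m⇒∣m*n m
  5≤p = coprime6⇒≥5 (prime>1 pp) 2∤p (3∤pm ∘ ∣m⇒∣m*n m)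
  5≤m = coprime6⇒≥5 1<m (2∤pm ∘ ∣n⇒∣m*n p) (3∤pm ∘ ∣n⇒∣m*n p)

coprime6-bound : 0 < n → ¬ 2 ∣ n → ¬ 3 ∣ n → 3 * n ≤ 2 * 3 ^ C n + 3
coprime6-bound = prime-induction P (λ _ _ → m≤n+m 3 2) step
  where
  P : ℕ → Set
  P n = ¬ 2 ∣ n → ¬ 3 ∣ n → 3 * n ≤ 2 * 3 ^ C n + 3
  step : ∀ {p m} → Prime p → 0 < m → (∀ {k} → 0 < k → k < p * m → P k) → P (p * m)
  step {p} {m} pp 0<m rec 2∤pm 3∤pm with m≤n⇒m<n∨m≡n 0<m
  ... | inj₂ refl rewrite *-identityʳ p = odd-prime-bound pp 2∤pm
  ... | inj₁ 1<m = ≤-trans (prime*-bound pp 1<m 2∤pm 3∤pm m-bound) (m≤m+n _ 3)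
    where m-bound = rec 0<m (m<p*m pp 0<m) (2∤pm ∘ ∣n⇒∣m*n p) (3∤pm ∘ ∣n⇒∣m*n p)

prime*-composite⇒>1 : Prime p → Composite (p * m) → 1 < m
prime*-composite⇒>1 {p} {zero}    _  pm-composite =
  contradiction (subst (1 <_) (*-zeroʳ p) (nonTrivial⇒n>1 _ {{composite⇒nonTrivial pm-composite}})) (λ ())
prime*-composite⇒>1 {p} {suc zero} pp pm-composite =
  contradiction (subst Prime (sym (*-identityʳ p)) pp) (composite⇒¬prime pm-composite)
prime*-composite⇒>1 {m = suc (suc _)} _ _ = s<s z<s

composite-coprime6-bound : Composite n → ¬ 2 ∣ n → ¬ 3 ∣ n → 3 * n ≤ 2 * 3 ^ C n
composite-coprime6-bound {n} n-composite 2∤n 3∤n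
  with prime-factor (nonTrivial⇒n>1 n {{composite⇒nonTrivial n-composite}})
... | p , m , pp , refl = prime*-bound pp 1<m 2∤n 3∤n
  (coprime6-bound (<-trans z<s 1<m) (2∤n ∘ ∣n⇒∣m*n p) (3∤n ∘ ∣n⇒∣m*n p))
  where 1<m = prime*-composite⇒>1 pp n-composite

3*≤2*3^⇒≤2*3^∸1 : ∀ {m c} → 0 < c → 3 * m ≤ 2 * 3 ^ c → m ≤ 2 * 3 ^ (c ∸ 1)
3*≤2*3^⇒≤2*3^∸1 {m} {suc c} _ 3m≤ =
  *-cancelˡ-≤ 3 (subst (3 * m ≤_) (trans (sym (*-assoc 2 3 (3 ^ c))) (*-assoc 3 2 (3 ^ c))) 3m≤)

proposition3p1 : (k m : ℕ) → k > 2 → ¬ (2 ∣ m) → Composite m → ¬ (3 ∣ m) → Height m k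
    → m < 2 * 3 ^ (k ∸ 2) + 1
proposition3p1 k m k>2 2∤m m-composite 3∤m height
  with height-odd height (nonTrivial⇒n>1 m {{composite⇒nonTrivial m-composite}}) 2∤m
... | refl = begin-strict
  m                      ≤⟨ 3*≤2*3^⇒≤2*3^∸1 0<Cm (composite-coprime6-bound m-composite 2∤m 3∤m) ⟩
  2 * 3 ^ (C m ∸ 1)      <⟨ m<m+n _ z<s ⟩
  2 * 3 ^ (C m ∸ 1) + 1  ∎
  where
  open ≤-Reasoning
  0<Cm = <-trans z<s (≤-pred k>2)
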